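{- Let $\mathfrak{S}$ be a finite subset of $\mathbb{Z}^2$, and let $(H,\rho)$ be a Gessel pair, where $H\subseteq\mathfrak{S}^*$. Then every path $\pi\in H$ has a unique factorization $\pi=\pi_-\pi_0\pi_+$ (product = concatenation) where $\pi_-$ is a minus-path, $\pi_0$ is a zero-path, and $\pi_+$ is a plus-path of $(H,\rho)$.
   Context: A path is a finite sequence of lattice points $(a_0,b_0),\dots,(a_n,b_n)$ in $\mathbb{Z}^2$ with $(a_0,b_0)=(0,0)$; its steps are $(a_i-a_{i-1},b_i-b_{i-1})$ and $n$ is its length. $\mathfrak{S}^*$ denotes the set of paths all of whose steps lie in $\mathfrak{S}$. The product $\sigma_1\sigma_2$ of two paths is the path whose steps are those of $\sigma_1$ followed by those of $\sigma_2$; the empty path $\varepsilon$ is the unit. A monoid is free if every element factors uniquely as a product of primes (elements with no nontrivial factorization). A Gessel pair $(H,\rho)$ consists of a subset $H\subseteq\mathfrak{S}^*$ which is a free monoid under concatenation, together with a homomorphism $\rho:H\to\mathbb{Z}$ (i.e. $\rho(\varepsilon)=0$ and $\rho(\sigma_1\sigma_2)=\rho(\sigma_1)+\rho(\sigma_2)$). For $\sigma\in H$ with prime factorization $\sigma=h_1h_2\cdots h_m$ in $H$, the $H$-heads of $\sigma$ are $h_1\cdots h_i$ for $i=0,1,\dots,m$. A minus-path is an element of $H$ that is either the empty path or has negative $\rho$ value strictly less than the $\rho$ values of all its other $H$-heads. A zero-path is an element of $H$ with $\rho$ value $0$ all of whose $H$-heads have nonnegative $\rho$ values. A plus-path is an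 element of $H$ all of whose $H$-heads other than $\varepsilon$ have positive $\rho$ values. -}

module Defs where

open import Data.Integer using (ℤ; _<_; _≤_; _+_; +_)
open import Data.Product using (_×_; Σ; ∃; ∃-syntax; _,_)
open import Data.Sum using (_⊎_)
open import Data.Nat using (ℕ)
open import Data.List using (List; []; _∷_; _++_; concat; take)
open import Data.List.Membership.Propositional using (_∈_)
open import Data.List.Relation.Unary.All using (All)
open import Relation.Binary.PropositionalEquality using (_≡_; _≢_)
open import Relation.Nullary using (¬_)

Step : Set
Step = ℤ × ℤ

-- A path starting at (0,0) is determined by its list of steps;
-- concatenation of step lists is the product of paths, [] is ε.
Path : Set
Path = List Step

InStar : List Step → Path → Set
InStar 𝔖 σ = All (_∈ 𝔖) σ

IsPrime : (Path → Set) → Path → Set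
IsPrime H h = H h × h ≢ [] ×
  (∀ a b → H a → H b → a ++ b ≡ h → a ≡ [] ⊎ b ≡ [])

record IsFreeMonoid (H : Path → Set) : Set where
  field
    unit-mem  : H []
    mul-mem   : ∀ {a b} → H a → H b → H (a ++ b)
    factor    : ∀ σ → H σ → Σ (List Path) λ ps → All (IsPrime H) ps × concat ps ≡ σ
    factor-unique : ∀ ps qs → All (IsPrime H) ps → All (IsPrime H) qs →
                    concat ps ≡ concat qs → ps ≡ qs

-- ρ : H → ℤ is a monoid homomorphism (ρ is given as a function on all paths;
-- only its values on H matter).
IsHom : (Path → Set) → (Path → ℤ) → Set
IsHom H ρ = (ρ [] ≡ + 0) × (∀ a b → H a → H b → ρ (a ++ b) ≡ ρ a + ρ b)

record IsGesselPair (𝔖 : List Step) (H : Path → Set) (ρ : Path → ℤ) : Set where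
  field
    sub  : ∀ σ → H σ → InStar 𝔖 σ
    free : IsFreeMonoid H
    hom  : IsHom H ρ

IsHead : (Path → Set) → Path → Path → Set
IsHead H σ τ = Σ (List Path) λ ps → All (IsPrime H) ps × concat ps ≡ σ ×
               ∃[ i ] τ ≡ concat (take i ps)

IsMinus : (Path → Set) → (Path → ℤ) → Path → Set
IsMinus H ρ σ = H σ × (σ ≡ [] ⊎
  (ρ σ < + 0 × (∀ τ → IsHead H σ τ → τ ≢ σ → ρ σ < ρ τ)))

IsZero : (Path → Set) → (Path → ℤ) → Path → Set
IsZero H ρ σ = H σ × ρ σ ≡ + 0 × (∀ τ → IsHead H σ τ → + 0 ≤ ρ τ)

IsPlus : (Path → Set) → (Path → ℤ) → Path → Set
IsPlus H ρ σ = H σ × (∀ τ → IsHead H σ τ → τ ≢ [] → + 0 < ρ τ)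

{-# OPTIONS --safe #-}
-- Factor π = h₁⋯hₘ into primes of H and look at the walk of prefix sums ρ(h₁⋯hᵢ): π₋ ends
-- at the first time the walk attains its minimum, π₋π₀ at the last such time, and π₊ is the
-- rest. For uniqueness, the
-- three conditions force π₋ and π₋π₀ to be the shortest and the longest minimising prefix,
-- and unique factorisation identifies H-heads with prefixes of the list of primes.
module Submission where

open import Defs
open import Data.Integer using (ℤ)
open import Data.Product using (_×_; _,_; ∃!)
open import Data.List using (List; _++_)
open import Relation.Binary.PropositionalEquality using (_≡_)

open import Data.Integer using (+_; _+_; _<_; _≤_; nonNegative)
open import Data.Integer.Properties
  using (+-identityˡ; +-identityʳ; +-assoc; +-monoʳ-≤; +-monoʳ-<; i≤i+j; ≤-refl;
         <⇒≤; <⇒≱; <-≤-trans; <-cmp; module ≤-Reasoning)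
import Data.Nat as ℕ
import Data.Nat.Properties as ℕ
open import Data.Product using (Σ; ∃; ∃₂; proj₁; proj₂)
open import Data.Sum using (_⊎_; inj₁; inj₂)
open import Data.Empty using (⊥-elim)
open import Function using (_∘_)
open import Data.List using ([]; _∷_; concat; take; drop; length)
open import Data.List.Properties
  using (∷-injective; ++-assoc; ++-identityʳ; ++-identityʳ-unique; ++-cancelˡ; ++-conicalʳ;
         length-++; length-++-≤ˡ; concat-++; take++drop≡id)
open import Data.List.Relation.Unary.All using (All; []; _∷_)
open import Data.List.Relation.Unary.All.Properties using (++⁺; ++⁻ˡ; ++⁻ʳ)
open import Relation.Binary.Definitions using (tri<; tri≈; tri>)
open import Relation.Binary.PropositionalEquality
  using (_≢_; refl; sym; trans; cong; cong₂; subst; subst₂; module ≡-Reasoning)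

module _ {A : Set} where

  take-length-++ : (p q : List A) → take (length p) (p ++ q) ≡ p
  take-length-++ []      q = refl
  take-length-++ (x ∷ p) q = cong (x ∷_) (take-length-++ p q)

  prefix-unique : ∀ {p q p′ q′ xs : List A} → p ++ q ≡ xs → p′ ++ q′ ≡ xs →
                  length p ≡ length p′ → p ≡ p′
  prefix-unique {p} {q} {p′} {q′} refl e l = begin
    p                                ≡⟨ take-length-++ p q ⟨
    take (length p) (p ++ q)         ≡⟨ cong₂ take l (sym e) ⟩
    take (length p′) (p′ ++ q′)      ≡⟨ take-length-++ p′ q′ ⟩
    p′                               ∎
    where open ≡-Reasoning

  prefix-length-≤ : ∀ {p q xs : List A} → p ++ q ≡ xs → length p ℕ.≤ length xs
  prefix-length-≤ {p} e = subst (length p ℕ.≤_) (cong length e) (length-++-≤ˡ p)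

  prefix-or-extends : ∀ (p q a r : List A) → p ++ q ≡ a ++ r →
    (∃ λ t → t ≢ [] × p ++ t ≡ a) ⊎ (∃ λ t → p ≡ a ++ t × t ++ q ≡ r)
  prefix-or-extends []      q []      r e = inj₂ ([] , refl , e)
  prefix-or-extends []      q (y ∷ a) r e = inj₁ (y ∷ a , (λ ()) , refl)
  prefix-or-extends (x ∷ p) q []      r e = inj₂ (x ∷ p , refl , e)
  prefix-or-extends (x ∷ p) q (y ∷ a) r e with ∷-injective e
  ... | refl , e′ with prefix-or-extends p q a r e′
  ...   | inj₁ (t , t≢[] , p++t≡a) = inj₁ (t , t≢[] , cong (x ∷_) p++t≡a)
  ...   | inj₂ (t , p≡a++t , t++q≡r) = inj₂ (t , cong (x ∷_) p≡a++t , t++q≡r)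

i<i+j : ∀ i {j} → + 0 < j → i < i + j
i<i+j i 0<j = subst (_< i + _) (+-identityʳ i) (+-monoʳ-< i 0<j)

module Weighted {A : Set} (f : A → ℤ) where

  weight : List A → ℤ
  weight []       = + 0
  weight (x ∷ xs) = f x + weight xs

  weight-++ : ∀ p q → weight (p ++ q) ≡ weight p + weight q
  weight-++ []      q = sym (+-identityˡ (weight q))
  weight-++ (x ∷ p) q =
    trans (cong (_+_ (f x)) (weight-++ p q)) (sym (+-assoc (f x) (weight p) (weight q)))

  IsMinusWord : List A → Set
  IsMinusWord a = a ≡ [] ⊎ (weight a < + 0 × (∀ p t → p ++ t ≡ a → t ≢ [] → weight a < weight p))

  IsZeroWord : List A → Set
  IsZeroWord b = weight b ≡ + 0 × (∀ p t → p ++ t ≡ b → + 0 ≤ weight p)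

  IsPlusWord : List A → Set
  IsPlusWord c = ∀ p t → p ++ t ≡ c → p ≢ [] → + 0 < weight p

  minusWord-properPrefix : ∀ {a p t} → IsMinusWord a → p ++ t ≡ a → t ≢ [] → weight a < weight p
  minusWord-properPrefix {p = p} {t} (inj₁ refl) e t≢[] = ⊥-elim (t≢[] (++-conicalʳ p t e))
  minusWord-properPrefix         (inj₂ (_ , below)) e t≢[] = below _ _ e t≢[]

  weight-++-zeroWord : ∀ a {b} → IsZeroWord b → weight (a ++ b) ≡ weight a
  weight-++-zeroWord a {b} (flat , _) =
    trans (weight-++ a b) (trans (cong (_+_ (weight a)) flat) (+-identityʳ (weight a)))

  record Decomposition (xs : List A) : Set where
    constructor mkDecomposition
    field
      minus zero plus : List A
      minus-word : IsMinusWord minus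
      zero-word  : IsZeroWord zero
      plus-word  : IsPlusWord plus
      splits     : minus ++ zero ++ plus ≡ xs

    components : List A × List A × List A
    components = minus , zero , plus

  module _ {xs} (d : Decomposition xs) where
    open Decomposition d

    InZeroWindow : List A → Set
    InZeroWindow p =
      weight minus ≤ weight p × length minus ℕ.≤ length p × length p ℕ.≤ length (minus ++ zero)

    zeroPrefix-inZeroWindow : ∀ t u → t ++ u ≡ zero → InZeroWindow (minus ++ t)
    zeroPrefix-inZeroWindow t u e =
      subst (weight minus ≤_) (sym (weight-++ minus t))
        (i≤i+j (weight minus) (weight t) {{nonNegative (proj₂ zero-word t u e)}}) ,
      subst (length minus ℕ.≤_) (sym (length-++ minus)) (ℕ.m≤m+n (length minus) (length t)) ,
      prefix-length-≤ {p = minus ++ t} (trans (++-assoc minus t u) (cong (minus ++_) e))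

    prefix-above-or-inZeroWindow : ∀ p q → p ++ q ≡ xs → weight minus < weight p ⊎ InZeroWindow p
    prefix-above-or-inZeroWindow p q e
      with prefix-or-extends p q minus (zero ++ plus) (trans e (sym splits))
    ... | inj₁ (t , t≢[] , p++t≡minus) = inj₁ (minusWord-properPrefix minus-word p++t≡minus t≢[])
    ... | inj₂ (t , refl , t++q≡zero++plus) with prefix-or-extends t q zero plus t++q≡zero++plus
    ...   | inj₁ (u , _ , t++u≡zero) = inj₂ (zeroPrefix-inZeroWindow t u t++u≡zero)
    ...   | inj₂ ([] , t≡zero++[] , _) =
      inj₂ (zeroPrefix-inZeroWindow t []
              (trans (++-identityʳ t) (trans t≡zero++[] (++-identityʳ zero))))
    ...   | inj₂ (y ∷ v , refl , y∷v++q≡plus) = inj₁ (begin-strict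
      weight minus
        <⟨ i<i+j (weight minus) (plus-word (y ∷ v) q y∷v++q≡plus (λ ())) ⟩
      weight minus + weight (y ∷ v)
        ≡⟨ cong (_+ weight (y ∷ v)) (weight-++-zeroWord minus zero-word) ⟨
      weight (minus ++ zero) + weight (y ∷ v)
        ≡⟨ weight-++ (minus ++ zero) (y ∷ v) ⟨
      weight ((minus ++ zero) ++ y ∷ v)
        ≡⟨ cong weight (++-assoc minus zero (y ∷ v)) ⟩
      weight (minus ++ zero ++ y ∷ v)
        ∎)
      where open ≤-Reasoning

    minimising-prefix-inZeroWindow : ∀ p q → p ++ q ≡ xs → weight p ≤ weight minus → InZeroWindow p
    minimising-prefix-inZeroWindow p q e p≤minus with prefix-above-or-inZeroWindow p q e
    ... | inj₁ minus<p = ⊥-elim (<⇒≱ minus<p p≤minus)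
    ... | inj₂ window  = window

    minus-minimal : ∀ p q → p ++ q ≡ xs → weight minus ≤ weight p
    minus-minimal p q e with prefix-above-or-inZeroWindow p q e
    ... | inj₁ minus<p          = <⇒≤ minus<p
    ... | inj₂ (minus≤p , _) = minus≤p

    splits-assoc : (minus ++ zero) ++ plus ≡ xs
    splits-assoc = trans (++-assoc minus zero plus) splits

    zeroWord-∷ : ∀ x → f x + weight minus ≡ + 0 → IsZeroWord (x ∷ minus ++ zero)
    zeroWord-∷ x flat = trans (cong (_+_ (f x)) (weight-++-zeroWord minus zero-word)) flat , nonneg
      where
      nonneg : ∀ p t → p ++ t ≡ x ∷ minus ++ zero → + 0 ≤ weight p
      nonneg []      t e = ≤-refl
      nonneg (y ∷ p) t e with ∷-injective e
      ... | refl , e′ = subst (_≤ f x + weight p) flat (+-monoʳ-≤ (f x) (minus-minimal p (t ++ plus)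
              (trans (sym (++-assoc p t plus)) (trans (cong (_++ plus) e′) splits-assoc))))

    plusWord-∷ : ∀ x → + 0 < f x + weight minus → IsPlusWord (x ∷ xs)
    plusWord-∷ x pos []      t e []≢[] = ⊥-elim ([]≢[] refl)
    plusWord-∷ x pos (y ∷ p) t e _ with ∷-injective e
    ... | refl , e′ = <-≤-trans pos (+-monoʳ-≤ (f x) (minus-minimal p t e′))

  open Decomposition

  minusWord-∷ : ∀ x {a} → f x + weight a < + 0 → IsMinusWord a → IsMinusWord (x ∷ a)
  minusWord-∷ x {a} neg a-minus = inj₂ (neg , below)
    where
    below : ∀ p t → p ++ t ≡ x ∷ a → t ≢ [] → f x + weight a < weight p
    below []      t e t≢[] = neg
    below (y ∷ p) t e t≢[] with ∷-injective e
    ... | refl , e′ = +-monoʳ-< (f x) (minusWord-properPrefix a-minus e′ t≢[])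

  zeroWord-[] : IsZeroWord []
  zeroWord-[] = refl , λ { [] t e → ≤-refl ; (_ ∷ _) t () }

  plusWord-[] : IsPlusWord []
  plusWord-[] []      t e []≢[] = ⊥-elim ([]≢[] refl)
  plusWord-[] (_ ∷ _) t ()

  -- f x + weight (minus d) is the least weight of a nonempty prefix of x ∷ xs, so its sign
  -- decides whether x joins π₋, x π₋ π₀ becomes the zero part, or x ∷ xs is a plus word.
  decompose-∷ : ∀ x {xs} → Decomposition xs → Decomposition (x ∷ xs)
  decompose-∷ x d with <-cmp (f x + weight (minus d)) (+ 0)
  ... | tri< neg _ _ =
    mkDecomposition (x ∷ minus d) (zero d) (plus d)
      (minusWord-∷ x neg (minus-word d)) (zero-word d) (plus-word d) (cong (x ∷_) (splits d))
  ... | tri≈ _ flat _ =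
    mkDecomposition [] (x ∷ minus d ++ zero d) (plus d)
      (inj₁ refl) (zeroWord-∷ d x flat) (plus-word d) (cong (x ∷_) (splits-assoc d))
  ... | tri> _ _ pos =
    mkDecomposition [] [] (x ∷ _) (inj₁ refl) zeroWord-[] (plusWord-∷ d x pos) refl

  decompose : ∀ xs → Decomposition xs
  decompose []       = mkDecomposition [] [] [] (inj₁ refl) zeroWord-[] plusWord-[] refl
  decompose (x ∷ xs) = decompose-∷ x (decompose xs)

  module _ {xs} (d e : Decomposition xs) where
    private
      module D = Decomposition d
      module E = Decomposition e

    minus-length-≤ : length D.minus ℕ.≤ length E.minus
    minus-length-≤ = proj₁ (proj₂ (minimising-prefix-inZeroWindow d E.minus _ E.splits
                                    (minus-minimal e D.minus _ D.splits)))

    window-length-≤ : length (E.minus ++ E.zero) ℕ.≤ length (D.minus ++ D.zero)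
    window-length-≤ = proj₂ (proj₂ (minimising-prefix-inZeroWindow d (E.minus ++ E.zero) _
      (splits-assoc e)
      (subst (_≤ weight D.minus) (sym (weight-++-zeroWord E.minus E.zero-word))
        (minus-minimal e D.minus _ D.splits))))

  components-unique : ∀ {xs} (d e : Decomposition xs) → components d ≡ components e
  components-unique d e = cong₂ _,_ minus≡ (cong₂ _,_ zero≡ plus≡)
    where
    minus≡ : minus d ≡ minus e
    minus≡ = prefix-unique (splits d) (splits e)
               (ℕ.≤-antisym (minus-length-≤ d e) (minus-length-≤ e d))
    window≡ : minus d ++ zero d ≡ minus e ++ zero e
    window≡ = prefix-unique (splits-assoc d) (splits-assoc e)
                (ℕ.≤-antisym (window-length-≤ e d) (window-length-≤ d e))
    zero≡ : zero d ≡ zero e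
    zero≡ = ++-cancelˡ (minus d) _ _ (trans window≡ (cong (_++ zero e) (sym minus≡)))
    plus≡ : plus d ≡ plus e
    plus≡ = ++-cancelˡ (minus d ++ zero d) _ _
              (trans (splits-assoc d)
                (trans (sym (splits-assoc e)) (cong (_++ plus e) (sym window≡))))

module FreeMonoid {H : Path → Set} {ρ : Path → ℤ} (free : IsFreeMonoid H) (hom : IsHom H ρ) where
  open IsFreeMonoid free
  open Weighted ρ
  open Decomposition using (components)

  Primes : List Path → Set
  Primes = All (IsPrime H)

  concat-mem : ∀ {ps} → Primes ps → H (concat ps)
  concat-mem []                       = unit-mem
  concat-mem ((p-mem , _) ∷ ps-prime) = mul-mem p-mem (concat-mem ps-prime)

  ρ-concat : ∀ {ps} → Primes ps → ρ (concat ps) ≡ weight ps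
  ρ-concat []                                = proj₁ hom
  ρ-concat {p ∷ ps} ((p-mem , _) ∷ ps-prime) =
    trans (proj₂ hom p (concat ps) p-mem (concat-mem ps-prime))
          (cong (_+_ (ρ p)) (ρ-concat ps-prime))

  concat-injective : ∀ {ps qs} → Primes ps → Primes qs → concat ps ≡ concat qs → ps ≡ qs
  concat-injective = factor-unique _ _

  prefix-primes : ∀ {ps} → Primes ps → ∀ p {t} → p ++ t ≡ ps → Primes p
  prefix-primes ps-prime p refl = ++⁻ˡ p ps-prime

  ρ-concat-prefix : ∀ {ps} → Primes ps → ∀ p {t} → p ++ t ≡ ps → ρ (concat p) ≡ weight p
  ρ-concat-prefix ps-prime p e = ρ-concat (prefix-primes ps-prime p e)

  concat-prefix-proper : ∀ {ps} → Primes ps → ∀ p {t} → p ++ t ≡ ps → concat p ≡ concat ps → t ≡ []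
  concat-prefix-proper ps-prime p e p≡ps =
    ++-identityʳ-unique p
      (trans (concat-injective (prefix-primes ps-prime p e) ps-prime p≡ps) (sym e))

  head⇒prefix : ∀ {ps τ} → Primes ps → IsHead H (concat ps) τ →
                ∃₂ λ p t → p ++ t ≡ ps × τ ≡ concat p
  head⇒prefix ps-prime (qs , qs-prime , qs≡ , i , refl) with concat-injective qs-prime ps-prime qs≡
  ... | refl = take i qs , drop i qs , take++drop≡id i qs , refl

  prefix⇒head : ∀ {ps} → Primes ps → ∀ p t → p ++ t ≡ ps → IsHead H (concat ps) (concat p)
  prefix⇒head ps-prime p t refl =
    p ++ t , ps-prime , refl , length p , cong concat (sym (take-length-++ p t))

  minusWord⇒isMinus : ∀ {a} → Primes a → IsMinusWord a → IsMinus H ρ (concat a)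
  minusWord⇒isMinus a-prime (inj₁ refl) = unit-mem , inj₁ refl
  minusWord⇒isMinus {a} a-prime (inj₂ (neg , below)) =
    concat-mem a-prime , inj₂ (subst (_< + 0) (sym (ρ-concat a-prime)) neg , below-heads)
    where
    below-heads : ∀ τ → IsHead H (concat a) τ → τ ≢ concat a → ρ (concat a) < ρ τ
    below-heads τ hd τ≢a with head⇒prefix a-prime hd
    ... | p , t , e , refl = subst₂ _<_ (sym (ρ-concat a-prime)) (sym (ρ-concat-prefix a-prime p e))
            (below p t e λ { refl → τ≢a (cong concat (trans (sym (++-identityʳ p)) e)) })

  isMinus⇒minusWord : ∀ {a} → Primes a → IsMinus H ρ (concat a) → IsMinusWord a
  isMinus⇒minusWord a-prime (_ , inj₁ a≡[]) = inj₁ (concat-injective a-prime [] a≡[])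
  isMinus⇒minusWord a-prime (_ , inj₂ (neg , below)) =
    inj₂ (subst (_< + 0) (ρ-concat a-prime) neg , λ p t e t≢[] →
      subst₂ _<_ (ρ-concat a-prime) (ρ-concat-prefix a-prime p e)
        (below (concat p) (prefix⇒head a-prime p t e) (t≢[] ∘ concat-prefix-proper a-prime p e)))

  zeroWord⇒isZero : ∀ {b} → Primes b → IsZeroWord b → IsZero H ρ (concat b)
  zeroWord⇒isZero {b} b-prime (flat , nonneg) =
    concat-mem b-prime , trans (ρ-concat b-prime) flat , nonneg-heads
    where
    nonneg-heads : ∀ τ → IsHead H (concat b) τ → + 0 ≤ ρ τ
    nonneg-heads τ hd with head⇒prefix b-prime hd
    ... | p , t , e , refl = subst (+ 0 ≤_) (sym (ρ-concat-prefix b-prime p e)) (nonneg p t e)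

  isZero⇒zeroWord : ∀ {b} → Primes b → IsZero H ρ (concat b) → IsZeroWord b
  isZero⇒zeroWord b-prime (_ , flat , nonneg) =
    trans (sym (ρ-concat b-prime)) flat , λ p t e →
      subst (+ 0 ≤_) (ρ-concat-prefix b-prime p e) (nonneg (concat p) (prefix⇒head b-prime p t e))

  plusWord⇒isPlus : ∀ {c} → Primes c → IsPlusWord c → IsPlus H ρ (concat c)
  plusWord⇒isPlus {c} c-prime pos = concat-mem c-prime , pos-heads
    where
    pos-heads : ∀ τ → IsHead H (concat c) τ → τ ≢ [] → + 0 < ρ τ
    pos-heads τ hd τ≢[] with head⇒prefix c-prime hd
    ... | p , t , e , refl =
      subst (+ 0 <_) (sym (ρ-concat-prefix c-prime p e)) (pos p t e λ { refl → τ≢[] refl })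

  isPlus⇒plusWord : ∀ {c} → Primes c → IsPlus H ρ (concat c) → IsPlusWord c
  isPlus⇒plusWord c-prime (_ , pos) p t e p≢[] =
    subst (+ 0 <_) (ρ-concat-prefix c-prime p e)
      (pos (concat p) (prefix⇒head c-prime p t e)
           (p≢[] ∘ concat-injective (prefix-primes c-prime p e) []))

  MinusZeroPlus : Path → Path × Path × Path → Set
  MinusZeroPlus π t = let (π₋ , π₀ , π₊) = t in
    IsMinus H ρ π₋ × IsZero H ρ π₀ × IsPlus H ρ π₊ × π₋ ++ π₀ ++ π₊ ≡ π

  concat³ : List Path × List Path × List Path → Path × Path × Path
  concat³ (a , b , c) = concat a , concat b , concat c

  concat-++³ : ∀ (a b c : List Path) → concat a ++ concat b ++ concat c ≡ concat (a ++ b ++ c)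
  concat-++³ a b c = trans (cong (concat a ++_) (concat-++ b c)) (concat-++ a (b ++ c))

  decomposition⇒minusZeroPlus : ∀ {ps} → Primes ps → (d : Decomposition ps) →
                                MinusZeroPlus (concat ps) (concat³ (components d))
  decomposition⇒minusZeroPlus abc-prime (mkDecomposition a b c a-minus b-zero c-plus refl) =
    minusWord⇒isMinus (++⁻ˡ a abc-prime) a-minus ,
    zeroWord⇒isZero (++⁻ˡ b bc-prime) b-zero ,
    plusWord⇒isPlus (++⁻ʳ b bc-prime) c-plus ,
    concat-++³ a b c
    where
    bc-prime : Primes (b ++ c)
    bc-prime = ++⁻ʳ a abc-prime

  minusZeroPlus⇒decomposition : ∀ {π t} → MinusZeroPlus π t →
    Σ (List Path) λ qs → Primes qs × concat qs ≡ π ×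
      Σ (Decomposition qs) λ d → concat³ (components d) ≡ t
  minusZeroPlus⇒decomposition {t = π₋ , π₀ , π₊} (π₋-minus , π₀-zero , π₊-plus , e)
    with factor π₋ (proj₁ π₋-minus) | factor π₀ (proj₁ π₀-zero) | factor π₊ (proj₁ π₊-plus)
  ... | a , a-prime , refl | b , b-prime , refl | c , c-prime , refl =
    a ++ b ++ c , ++⁺ a-prime (++⁺ b-prime c-prime) , trans (sym (concat-++³ a b c)) e ,
    mkDecomposition a b c (isMinus⇒minusWord a-prime π₋-minus) (isZero⇒zeroWord b-prime π₀-zero)
                          (isPlus⇒plusWord c-prime π₊-plus) refl ,
    refl

  minus-zero-plus : ∀ π → H π → ∃! _≡_ (MinusZeroPlus π)
  minus-zero-plus π π-mem with factor π π-mem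
  ... | ps , ps-prime , refl =
    concat³ (components d) , decomposition⇒minusZeroPlus ps-prime d , unique
    where
    d : Decomposition ps
    d = decompose ps
    unique : ∀ {t} → MinusZeroPlus (concat ps) t → concat³ (components d) ≡ t
    unique mzp with minusZeroPlus⇒decomposition mzp
    ... | qs , qs-prime , qs≡ps , e , refl with concat-injective qs-prime ps-prime qs≡ps
    ... | refl = cong concat³ (components-unique d e)

lemma3p1 : (𝔖 : List Step) (H : Path → Set) (ρ : Path → ℤ) → IsGesselPair 𝔖 H ρ →
    ∀ π → H π →
    ∃! _≡_ (λ (t : Path × Path × Path) → let (π₋ , π₀ , π₊) = t in
      IsMinus H ρ π₋ × IsZero H ρ π₀ × IsPlus H ρ π₊ × π₋ ++ π₀ ++ π₊ ≡ π)
lemma3p1 𝔖 H ρ G = FreeMonoid.minus-zero-plus free hom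
  where open IsGesselPair G
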